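{- Let $f\in\mathbb{Z}[t]$ be a polynomial having at least two different (non-associate) irreducible factors of positive degree in $\mathbb{Z}[t]$. Then there are only finitely many integers $t\in\mathbb{Z}$ such that $f(t)=p^e$ for some prime $p$ and some integer $e\ge 1$.
   Context: Two irreducible polynomials in $\mathbb{Z}[t]$ are associate if they differ only by a sign. -}

module Defs where

open import Data.Nat using (ℕ; zero; suc)
open import Data.Integer using (ℤ; _+_; _*_; -_; 0ℤ; 1ℤ)
open import Data.List using (List; []; _∷_; map)
open import Data.Product using (Σ; _×_; ∃; ∃-syntax)
open import Data.Sum using (_⊎_)
open import Relation.Binary.PropositionalEquality using (_≡_; _≢_)
open import Relation.Nullary using (¬_)

-- Polynomials in ℤ[t], as coefficient lists, lowest degree first.
-- Trailing zeros are allowed; equality of polynomials is ≈ₚ (equal coefficients).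
Poly : Set
Poly = List ℤ

coeff : Poly → ℕ → ℤ
coeff []      _       = 0ℤ
coeff (a ∷ p) zero    = a
coeff (a ∷ p) (suc n) = coeff p n

_≈ₚ_ : Poly → Poly → Set
p ≈ₚ q = ∀ n → coeff p n ≡ coeff q n

infix 4 _≈ₚ_
infixl 6 _+ₚ_
infixl 7 _*ₚ_

_+ₚ_ : Poly → Poly → Poly
[]      +ₚ q       = q
(a ∷ p) +ₚ []      = a ∷ p
(a ∷ p) +ₚ (b ∷ q) = (a + b) ∷ (p +ₚ q)

scaleₚ : ℤ → Poly → Poly
scaleₚ c p = map (c *_) p

negₚ : Poly → Poly
negₚ p = map -_ p

_*ₚ_ : Poly → Poly → Poly
[]      *ₚ q = []
(a ∷ p) *ₚ q = scaleₚ a q +ₚ (0ℤ ∷ (p *ₚ q))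

oneₚ : Poly
oneₚ = 1ℤ ∷ []

eval : Poly → ℤ → ℤ
eval []      x = 0ℤ
eval (a ∷ p) x = a + x * eval p x

IsZeroₚ : Poly → Set
IsZeroₚ p = ∀ n → coeff p n ≡ 0ℤ

IsUnitₚ : Poly → Set
IsUnitₚ p = ∃[ q ] (p *ₚ q ≈ₚ oneₚ)

_∣ₚ_ : Poly → Poly → Set
g ∣ₚ f = ∃[ h ] (g *ₚ h ≈ₚ f)

Irreducibleₚ : Poly → Set
Irreducibleₚ p =
  ¬ IsZeroₚ p × ¬ IsUnitₚ p ×
  (∀ a b → p ≈ₚ a *ₚ b → IsUnitₚ a ⊎ IsUnitₚ b)

PositiveDegree : Poly → Set
PositiveDegree p = ∃[ n ] (coeff p (suc n) ≢ 0ℤ)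

Associated : Poly → Poly → Set
Associated p q = p ≈ₚ q ⊎ p ≈ₚ negₚ q

-- Let g and h be the two irreducible factors. By Gauss's lemma, an irreducible polynomial
-- of positive degree that is divisible over ℚ by some r of positive degree is a constant
-- multiple of r; as g and h are not associates, they have no common factor of positive
-- degree even over ℚ, and Euclid's algorithm with pseudo-remainders yields u, v ∈ ℤ[t] and
-- an integer N ≠ 0 with u g + v h = N. If f(t) = pᵉ, then g(t) and h(t) both divide pᵉ, so
-- one of them divides the other and hence divides N. Since a polynomial g of positive
-- degree satisfies |t| ≤ |g(t)| + M for a constant M, this bounds |t|.
module Submission where

open import Defs
open import Data.Nat as ℕ using (ℕ; zero; suc; z≤n; s≤s; _≤_; _∸_; _^_)
import Data.Nat.Properties as ℕP
open import Data.Integer as ℤ using (ℤ; +_; -[1+_]; ∣_∣; _+_; _*_; -_; _-_; 0ℤ; 1ℤ)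
import Data.Integer.Properties as ℤP
open import Data.Integer.Divisibility.Signed as ℤD using (divides)
import Data.Nat.Divisibility as ℕD
open import Data.Nat.Primality using (Prime; euclidsLemma; prime⇒nonZero; prime⇒irreducible)
open import Data.Nat.Coprimality using (Coprime; coprime-divisor)
open import Data.Nat.Primality.Factorisation using (PrimeFactorisation; factorise)
open import Data.Nat.ListAction using (product)
open import Data.List.Relation.Unary.All using (All; []; _∷_)
open import Data.Integer.Tactic.RingSolver using (solve-∀)
open import Data.List using ([]; _∷_; length)
open import Data.Product using (_×_; _,_; ∃-syntax)
open import Data.Sum using (_⊎_; inj₁; inj₂; [_,_]′)
open import Data.Empty using (⊥-elim)
open import Function using (_∘_)
open import Relation.Binary.PropositionalEquality
open import Relation.Nullary using (¬_; yes; no)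

coeff-+ₚ : ∀ p q n → coeff (p +ₚ q) n ≡ coeff p n + coeff q n
coeff-+ₚ []      q       n       = sym (ℤP.+-identityˡ _)
coeff-+ₚ (a ∷ p) []      n       = sym (ℤP.+-identityʳ _)
coeff-+ₚ (a ∷ p) (b ∷ q) zero    = refl
coeff-+ₚ (a ∷ p) (b ∷ q) (suc n) = coeff-+ₚ p q n

coeff-scaleₚ : ∀ c p n → coeff (scaleₚ c p) n ≡ c * coeff p n
coeff-scaleₚ c []      n       = sym (ℤP.*-zeroʳ c)
coeff-scaleₚ c (a ∷ p) zero    = refl
coeff-scaleₚ c (a ∷ p) (suc n) = coeff-scaleₚ c p n

coeff-negₚ : ∀ p n → coeff (negₚ p) n ≡ - coeff p n
coeff-negₚ []      n       = refl
coeff-negₚ (a ∷ p) zero    = refl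
coeff-negₚ (a ∷ p) (suc n) = coeff-negₚ p n

eval-+ₚ : ∀ p q t → eval (p +ₚ q) t ≡ eval p t + eval q t
eval-+ₚ []      q       t = sym (ℤP.+-identityˡ _)
eval-+ₚ (a ∷ p) []      t = sym (ℤP.+-identityʳ _)
eval-+ₚ (a ∷ p) (b ∷ q) t rewrite eval-+ₚ p q t = step a b t (eval p t) (eval q t)
  where
  step : ∀ a b t x y → (a + b) + t * (x + y) ≡ (a + t * x) + (b + t * y)
  step = solve-∀

eval-scaleₚ : ∀ c p t → eval (scaleₚ c p) t ≡ c * eval p t
eval-scaleₚ c []      t = sym (ℤP.*-zeroʳ c)
eval-scaleₚ c (a ∷ p) t rewrite eval-scaleₚ c p t = step c a t (eval p t)
  where
  step : ∀ c a t x → c * a + t * (c * x) ≡ c * (a + t * x)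
  step = solve-∀

eval-negₚ : ∀ p t → eval (negₚ p) t ≡ - eval p t
eval-negₚ []      t = refl
eval-negₚ (a ∷ p) t rewrite eval-negₚ p t = step a t (eval p t)
  where
  step : ∀ a t x → - a + t * - x ≡ - (a + t * x)
  step = solve-∀

eval-*ₚ : ∀ p q t → eval (p *ₚ q) t ≡ eval p t * eval q t
eval-*ₚ []      q t = refl
eval-*ₚ (a ∷ p) q t
  rewrite eval-+ₚ (scaleₚ a q) (0ℤ ∷ (p *ₚ q)) t | eval-scaleₚ a q t | eval-*ₚ p q t
  = step a t (eval p t) (eval q t)
  where
  step : ∀ a t x y → a * y + (0ℤ + t * (x * y)) ≡ (a + t * x) * y
  step = solve-∀

eval-const : ∀ c t → eval (c ∷ []) t ≡ c
eval-const c t = trans (cong (λ v → c + v) (ℤP.*-zeroʳ t)) (ℤP.+-identityʳ c)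

eval-oneₚ : ∀ t → eval oneₚ t ≡ 1ℤ
eval-oneₚ = eval-const 1ℤ

eval-isZero : ∀ p → IsZeroₚ p → ∀ t → eval p t ≡ 0ℤ
eval-isZero []      z t = refl
eval-isZero (a ∷ p) z t
  rewrite z zero | eval-isZero p (λ n → z (suc n)) t | ℤP.*-zeroʳ t = refl

eval-cong : ∀ p q → p ≈ₚ q → ∀ t → eval p t ≡ eval q t
eval-cong []      []      e t = refl
eval-cong []      (b ∷ q) e t = sym (eval-isZero (b ∷ q) (λ n → sym (e n)) t)
eval-cong (a ∷ p) []      e t = eval-isZero (a ∷ p) e t
eval-cong (a ∷ p) (b ∷ q) e t =
  cong₂ (λ u v → u + t * v) (e zero) (eval-cong p q (λ n → e (suc n)) t)

eval-constant : ∀ p → (∀ n → coeff p (suc n) ≡ 0ℤ) → ∀ t → eval p t ≡ coeff p 0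
eval-constant []      z t = refl
eval-constant (a ∷ p) z t rewrite eval-isZero p z t | ℤP.*-zeroʳ t = ℤP.+-identityʳ a

NonZeroₚ : Poly → Set
NonZeroₚ p = ∃[ n ] coeff p n ≢ 0ℤ

isZero⊎nonZero : ∀ p → IsZeroₚ p ⊎ NonZeroₚ p
isZero⊎nonZero [] = inj₁ (λ _ → refl)
isZero⊎nonZero (a ∷ p) with a ℤ.≟ 0ℤ | isZero⊎nonZero p
... | no a≢0 | _              = inj₂ (zero , a≢0)
... | yes _  | inj₂ (n , pn≢0) = inj₂ (suc n , pn≢0)
... | yes a≡0 | inj₁ p≡0      = inj₁ λ { zero → a≡0 ; (suc n) → p≡0 n }

¬positiveDegree⇒constant : ∀ p → ¬ PositiveDegree p → ∀ t → eval p t ≡ coeff p 0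
¬positiveDegree⇒constant p ¬pd = eval-constant p higher≡0
  where
  higher≡0 : ∀ n → coeff p (suc n) ≡ 0ℤ
  higher≡0 n with coeff p (suc n) ℤ.≟ 0ℤ
  ... | yes c≡0 = c≡0
  ... | no c≢0  = ⊥-elim (¬pd (n , c≢0))

∣t∣≤∣a+t*y∣+∣a∣ : ∀ a t y → y ≢ 0ℤ → ∣ t ∣ ≤ ∣ a + t * y ∣ ℕ.+ ∣ a ∣
∣t∣≤∣a+t*y∣+∣a∣ a t y y≢0 = begin
  ∣ t ∣                    ≡⟨ ℕP.*-identityʳ ∣ t ∣ ⟨
  ∣ t ∣ ℕ.* 1              ≤⟨ ℕP.*-monoʳ-≤ ∣ t ∣ (ℕP.n≢0⇒n>0 (y≢0 ∘ ℤP.∣i∣≡0⇒i≡0)) ⟩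
  ∣ t ∣ ℕ.* ∣ y ∣          ≡⟨ ℤP.abs-* t y ⟨
  ∣ t * y ∣                ≡⟨ cong ∣_∣ (cancel a (t * y)) ⟨
  ∣ (a + t * y) - a ∣      ≤⟨ ℤP.∣i-j∣≤∣i∣+∣j∣ (a + t * y) a ⟩
  ∣ a + t * y ∣ ℕ.+ ∣ a ∣  ∎
  where
  open ℕP.≤-Reasoning
  cancel : ∀ a x → (a + x) - a ≡ x
  cancel = solve-∀

eventually-nonRoot : ∀ p → NonZeroₚ p → ∃[ M ] (∀ t → M ≤ ∣ t ∣ → eval p t ≢ 0ℤ)
eventually-nonRoot []      (n , 0≢0) = ⊥-elim (0≢0 refl)
eventually-nonRoot (a ∷ q) nz with isZero⊎nonZero q
... | inj₂ q≢0 with eventually-nonRoot q q≢0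
...   | M , q[t]≢0 = M ℕ.+ suc ∣ a ∣ , λ t M+∣a∣<∣t∣ p[t]≡0 → ℕP.<-irrefl refl (begin-strict
  ∣ a ∣                            <⟨ ℕP.m≤n+m (suc ∣ a ∣) M ⟩
  M ℕ.+ suc ∣ a ∣                  ≤⟨ M+∣a∣<∣t∣ ⟩
  ∣ t ∣                            ≤⟨ ∣t∣≤∣a+t*y∣+∣a∣ a t (eval q t)
                                        (q[t]≢0 t (ℕP.≤-trans (ℕP.m≤m+n M (suc ∣ a ∣)) M+∣a∣<∣t∣)) ⟩
  ∣ eval (a ∷ q) t ∣ ℕ.+ ∣ a ∣     ≡⟨ cong (λ v → ∣ v ∣ ℕ.+ ∣ a ∣) p[t]≡0 ⟩
  ∣ a ∣                            ∎)
  where open ℕP.≤-Reasoning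
eventually-nonRoot (a ∷ q) (zero  , a≢0)  | inj₁ q≡0 = 0 , λ t _ p[t]≡0 →
  a≢0 (trans (sym (eval-constant (a ∷ q) q≡0 t)) p[t]≡0)
eventually-nonRoot (a ∷ q) (suc n , qn≢0) | inj₁ q≡0 = ⊥-elim (qn≢0 (q≡0 n))

Growth : Poly → Set
Growth p = ∃[ M ] (∀ t → ∣ t ∣ ≤ ∣ eval p t ∣ ℕ.+ M)

positiveDegree-growth : ∀ p → PositiveDegree p → Growth p
positiveDegree-growth []      (n , 0≢0) = ⊥-elim (0≢0 refl)
positiveDegree-growth (a ∷ q) q≢0 with eventually-nonRoot q q≢0
... | M , q[t]≢0 = M ℕ.+ ∣ a ∣ , growth
  where
  growth : ∀ t → ∣ t ∣ ≤ ∣ a + t * eval q t ∣ ℕ.+ (M ℕ.+ ∣ a ∣)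
  growth t with M ℕ.≤? ∣ t ∣
  ... | yes M≤∣t∣ = ℕP.≤-trans (∣t∣≤∣a+t*y∣+∣a∣ a t (eval q t) (q[t]≢0 t M≤∣t∣))
                      (ℕP.+-monoʳ-≤ ∣ a + t * eval q t ∣ (ℕP.m≤n+m ∣ a ∣ M))
  ... | no  M≰∣t∣ = ℕP.≤-trans (ℕP.<⇒≤ (ℕP.≰⇒> M≰∣t∣))
                      (ℕP.≤-trans (ℕP.m≤m+n M ∣ a ∣) (ℕP.m≤n+m (M ℕ.+ ∣ a ∣) ∣ a + t * eval q t ∣))

positiveDegree⇒unbounded : ∀ p B → PositiveDegree p → ¬ (∀ t → ∣ eval p t ∣ ≤ B)
positiveDegree⇒unbounded p B pd bounded with positiveDegree-growth p pd
... | M , growth = ℕP.<-irrefl refl (ℕP.≤-trans (growth t) (ℕP.+-monoˡ-≤ M (bounded t)))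
  where
  t : ℤ
  t = + suc (B ℕ.+ M)

-- Identities in ℤ[t] are proved on values, where the ring solver applies, and
-- transferred to coefficients by this lemma.
eval-injective : ∀ p q → (∀ t → eval p t ≡ eval q t) → p ≈ₚ q
eval-injective p q p≗q n with isZero⊎nonZero (p +ₚ negₚ q)
... | inj₂ d≢0 with eventually-nonRoot (p +ₚ negₚ q) d≢0
...   | M , d[t]≢0 = ⊥-elim (d[t]≢0 (+ M) ℕP.≤-refl (d≡0 (+ M)))
  where
  d≡0 : ∀ t → eval (p +ₚ negₚ q) t ≡ 0ℤ
  d≡0 t rewrite eval-+ₚ p (negₚ q) t | eval-negₚ q t | p≗q t = ℤP.+-inverseʳ (eval q t)
eval-injective p q p≗q n | inj₁ d≡0 = ℤP.i-j≡0⇒i≡j (coeff p n) (coeff q n) (begin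
  coeff p n - coeff q n             ≡⟨ cong (λ v → coeff p n + v) (coeff-negₚ q n) ⟨
  coeff p n + coeff (negₚ q) n      ≡⟨ coeff-+ₚ p (negₚ q) n ⟨
  coeff (p +ₚ negₚ q) n             ≡⟨ d≡0 n ⟩
  0ℤ                                ∎)
  where open ≡-Reasoning

∣ε∣≡1⇒ε*ε≡1 : ∀ ε → ∣ ε ∣ ≡ 1 → ε * ε ≡ 1ℤ
∣ε∣≡1⇒ε*ε≡1 (+ 1)    _ = refl
∣ε∣≡1⇒ε*ε≡1 -[1+ 0 ] _ = refl

∣ε*δ∣≡1 : ∀ ε δ → ∣ ε ∣ ≡ 1 → ∣ δ ∣ ≡ 1 → ∣ ε * δ ∣ ≡ 1
∣ε*δ∣≡1 ε δ ∣ε∣≡1 ∣δ∣≡1 rewrite ℤP.abs-* ε δ | ∣ε∣≡1 | ∣δ∣≡1 = refl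

*-≢0 : ∀ {i j} → i ≢ 0ℤ → j ≢ 0ℤ → i * j ≢ 0ℤ
*-≢0 {i} i≢0 j≢0 ij≡0 = [ i≢0 , j≢0 ]′ (ℤP.i*j≡0⇒i≡0∨j≡0 i ij≡0)

unit⇒∣eval∣≡1 : ∀ u → IsUnitₚ u → ∀ t → ∣ eval u t ∣ ≡ 1
unit⇒∣eval∣≡1 u (w , uw≈1) t = ℕP.m*n≡1⇒m≡1 ∣ eval u t ∣ ∣ eval w t ∣ (begin
  ∣ eval u t ∣ ℕ.* ∣ eval w t ∣  ≡⟨ ℤP.abs-* (eval u t) (eval w t) ⟨
  ∣ eval u t * eval w t ∣        ≡⟨ cong ∣_∣ (eval-*ₚ u w t) ⟨
  ∣ eval (u *ₚ w) t ∣            ≡⟨ cong ∣_∣ (eval-cong (u *ₚ w) oneₚ uw≈1 t) ⟩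
  ∣ eval oneₚ t ∣                ≡⟨ cong ∣_∣ (eval-oneₚ t) ⟩
  1                              ∎)
  where open ≡-Reasoning

unit⇒¬positiveDegree : ∀ u → IsUnitₚ u → ¬ PositiveDegree u
unit⇒¬positiveDegree u unit pd =
  positiveDegree⇒unbounded u 1 pd (ℕP.≤-reflexive ∘ unit⇒∣eval∣≡1 u unit)

unit⇒constant : ∀ u → IsUnitₚ u → ∃[ ε ] (∣ ε ∣ ≡ 1 × (∀ t → eval u t ≡ ε))
unit⇒constant u unit =
  coeff u 0 , trans (cong ∣_∣ (sym (u≡c 0ℤ))) (unit⇒∣eval∣≡1 u unit 0ℤ) , u≡c
  where
  u≡c : ∀ t → eval u t ≡ coeff u 0
  u≡c = ¬positiveDegree⇒constant u (unit⇒¬positiveDegree u unit)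

positiveDegree-multiple⇒¬unit : ∀ f k r → PositiveDegree f →
  (∀ t → eval f t ≡ k * eval r t) → ¬ IsUnitₚ r
positiveDegree-multiple⇒¬unit f k r pd f≡kr unit = positiveDegree⇒unbounded f ∣ k ∣ pd λ t →
  ℕP.≤-reflexive (begin
    ∣ eval f t ∣            ≡⟨ cong ∣_∣ (f≡kr t) ⟩
    ∣ k * eval r t ∣        ≡⟨ ℤP.abs-* k (eval r t) ⟩
    ∣ k ∣ ℕ.* ∣ eval r t ∣  ≡⟨ cong (∣ k ∣ ℕ.*_) (unit⇒∣eval∣≡1 r unit t) ⟩
    ∣ k ∣ ℕ.* 1             ≡⟨ ℕP.*-identityʳ ∣ k ∣ ⟩
    ∣ k ∣                   ∎)
  where open ≡-Reasoning

SignMultiple : Poly → Poly → Set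
SignMultiple g r = ∃[ ε ] (∣ ε ∣ ≡ 1 × (∀ t → eval g t ≡ ε * eval r t))

irreducible-factor : ∀ g q r → Irreducibleₚ g → ¬ IsUnitₚ r →
  (∀ t → eval g t ≡ eval q t * eval r t) → SignMultiple g r
irreducible-factor g q r (_ , _ , irreducible) ¬unit-r g≡qr
  with irreducible q r (eval-injective g (q *ₚ r) λ t → trans (g≡qr t) (sym (eval-*ₚ q r t)))
... | inj₂ unit-r = ⊥-elim (¬unit-r unit-r)
... | inj₁ unit-q with unit⇒constant q unit-q
...   | ε , ∣ε∣≡1 , q≡ε = ε , ∣ε∣≡1 , λ t → trans (g≡qr t) (cong (_* eval r t) (q≡ε t))

sign-multiple⇒associated : ∀ g h ε → ∣ ε ∣ ≡ 1 → (∀ t → eval g t ≡ ε * eval h t) → Associated g h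
sign-multiple⇒associated g h (+ 1) _ g≡h =
  inj₁ (eval-injective g h λ t → trans (g≡h t) (ℤP.*-identityˡ (eval h t)))
sign-multiple⇒associated g h -[1+ 0 ] _ g≡-h =
  inj₂ (eval-injective g (negₚ h) λ t →
    trans (g≡-h t) (trans (ℤP.-1*i≡-i (eval h t)) (sym (eval-negₚ h t))))

-- Gauss's lemma

infix 4 _∣ᶜ_
_∣ᶜ_ : ℤ → Poly → Set
k ∣ᶜ p = ∀ n → k ℤD.∣ coeff p n

euclidsLemma-ℤ : ∀ {p} → Prime p → ∀ x y → + p ℤD.∣ x * y → + p ℤD.∣ x ⊎ + p ℤD.∣ y
euclidsLemma-ℤ pr x y p∣xy
  with euclidsLemma ∣ x ∣ ∣ y ∣ pr (subst (_ ℕD.∣_) (ℤP.abs-* x y) (ℤD.∣⇒∣ᵤ p∣xy))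
... | inj₁ p∣x = inj₁ (ℤD.∣ᵤ⇒∣ p∣x)
... | inj₂ p∣y = inj₂ (ℤD.∣ᵤ⇒∣ p∣y)

*ₚ-comm : ∀ a b → a *ₚ b ≈ₚ b *ₚ a
*ₚ-comm a b = eval-injective (a *ₚ b) (b *ₚ a) λ t → begin
  eval (a *ₚ b) t        ≡⟨ eval-*ₚ a b t ⟩
  eval a t * eval b t    ≡⟨ ℤP.*-comm (eval a t) (eval b t) ⟩
  eval b t * eval a t    ≡⟨ eval-*ₚ b a t ⟨
  eval (b *ₚ a) t        ∎
  where open ≡-Reasoning

∣ᶜ-*ₚ-comm : ∀ k a b → k ∣ᶜ a *ₚ b → k ∣ᶜ b *ₚ a
∣ᶜ-*ₚ-comm k a b k∣ab n = subst (k ℤD.∣_) (*ₚ-comm a b n) (k∣ab n)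

∣ᶜ-*ₚ-tail : ∀ k a₀ a b → k ℤD.∣ a₀ → k ∣ᶜ (a₀ ∷ a) *ₚ b → k ∣ᶜ a *ₚ b
∣ᶜ-*ₚ-tail k a₀ a b k∣a₀ k∣ab n = ℤD.∣m+n∣m⇒∣n k∣coeff (ℤD.∣m⇒∣m*n (coeff b (suc n)) k∣a₀)
  where
  k∣coeff : k ℤD.∣ a₀ * coeff b (suc n) + coeff (a *ₚ b) n
  k∣coeff = subst (k ℤD.∣_)
    (trans (coeff-+ₚ (scaleₚ a₀ b) (0ℤ ∷ (a *ₚ b)) (suc n))
           (cong (λ v → v + coeff (a *ₚ b) n) (coeff-scaleₚ a₀ b (suc n))))
    (k∣ab (suc n))

gauss-lemma : ∀ {p} → Prime p → ∀ a b → + p ∣ᶜ a *ₚ b → + p ∣ᶜ a ⊎ + p ∣ᶜ b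
gauss-lemma {p} pr []       b p∣ab = inj₁ λ n → divides 0ℤ refl
gauss-lemma {p} pr (a₀ ∷ a) b p∣ab with + p ℤD.∣? a₀
... | yes p∣a₀ with gauss-lemma pr a b (∣ᶜ-*ₚ-tail (+ p) a₀ a b p∣a₀ p∣ab)
...   | inj₁ p∣a = inj₁ λ { zero → p∣a₀ ; (suc n) → p∣a n }
...   | inj₂ p∣b = inj₂ p∣b
gauss-lemma {p} pr (a₀ ∷ a) []       p∣ab | no p∤a₀ = inj₂ λ n → divides 0ℤ refl
gauss-lemma {p} pr (a₀ ∷ a) (b₀ ∷ b) p∣ab | no p∤a₀ with + p ℤD.∣? b₀
... | yes p∣b₀ with gauss-lemma pr (a₀ ∷ a) b
                      (∣ᶜ-*ₚ-comm (+ p) b (a₀ ∷ a)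
                        (∣ᶜ-*ₚ-tail (+ p) b₀ b (a₀ ∷ a) p∣b₀ (∣ᶜ-*ₚ-comm (+ p) (a₀ ∷ a) (b₀ ∷ b) p∣ab)))
...   | inj₁ p∣a = inj₁ p∣a
...   | inj₂ p∣b = inj₂ λ { zero → p∣b₀ ; (suc n) → p∣b n }
gauss-lemma {p} pr (a₀ ∷ a) (b₀ ∷ b) p∣ab | no p∤a₀ | no p∤b₀
  with euclidsLemma-ℤ pr a₀ b₀ (subst (+ p ℤD.∣_) (ℤP.+-identityʳ (a₀ * b₀)) (p∣ab zero))
... | inj₁ p∣a₀ = ⊥-elim (p∤a₀ p∣a₀)
... | inj₂ p∣b₀ = ⊥-elim (p∤b₀ p∣b₀)

∣ᶜ⇒multiple : ∀ k p → k ∣ᶜ p → ∃[ p′ ] (∀ t → eval p t ≡ k * eval p′ t)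
∣ᶜ⇒multiple k []      _   = [] , λ t → sym (ℤP.*-zeroʳ k)
∣ᶜ⇒multiple k (a ∷ p) k∣p with k∣p zero | ∣ᶜ⇒multiple k p (k∣p ∘ suc)
... | divides a′ refl | p′ , p≡kp′ = a′ ∷ p′ , λ t →
  trans (cong (λ v → a′ * k + t * v) (p≡kp′ t)) (factor-out a′ k t (eval p′ t))
  where
  factor-out : ∀ a′ k t x → a′ * k + t * (k * x) ≡ k * (a′ + t * x)
  factor-out = solve-∀

ScaledFactor : Poly → Poly → Set
ScaledFactor g r = ∃[ q₁ ] ∃[ r₁ ] ∃[ k ]
  ((∀ t → eval r t ≡ k * eval r₁ t) × (∀ t → eval g t ≡ eval q₁ t * eval r₁ t))

PrimeCancelled : ℕ → ℤ → Poly → Poly → Poly → Set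
PrimeCancelled p c g q r =
  ∃[ q′ ] ((∀ t → eval q t ≡ + p * eval q′ t) × (∀ t → c * eval g t ≡ eval q′ t * eval r t)) ⊎
  ∃[ r′ ] ((∀ t → eval r t ≡ + p * eval r′ t) × (∀ t → c * eval g t ≡ eval q t * eval r′ t))

cancel-prime : ∀ {p} → Prime p → ∀ c g q r → (∀ t → (c * + p) * eval g t ≡ eval q t * eval r t) →
  PrimeCancelled p c g q r
cancel-prime {p} pr c g q r cpg≡qr = cancel (gauss-lemma pr q r p∣qr)
  where
  open ≡-Reasoning
  instance _ = prime⇒nonZero pr

  p∣qr : + p ∣ᶜ q *ₚ r
  p∣qr n = subst (+ p ℤD.∣_)
    (sym (trans (eval-injective (q *ₚ r) (scaleₚ (c * + p) g)
                  (λ t → trans (eval-*ₚ q r t) (trans (sym (cpg≡qr t)) (sym (eval-scaleₚ (c * + p) g t)))) n)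
                (coeff-scaleₚ (c * + p) g n)))
    (ℤD.∣m⇒∣m*n (coeff g n) (ℤD.∣n⇒∣m*n c (ℤD.∣-refl {+ p})))

  p*cg≡qr : ∀ t → + p * (c * eval g t) ≡ eval q t * eval r t
  p*cg≡qr t = trans (rearrange (+ p) c (eval g t)) (cpg≡qr t)
    where
    rearrange : ∀ x y z → x * (y * z) ≡ (y * x) * z
    rearrange = solve-∀

  cancel : + p ∣ᶜ q ⊎ + p ∣ᶜ r → PrimeCancelled p c g q r
  cancel (inj₁ p∣q) with ∣ᶜ⇒multiple (+ p) q p∣q
  ... | q′ , q≡pq′ = inj₁ (q′ , q≡pq′ , λ t → ℤP.*-cancelˡ-≡ (+ p) _ _ (begin
    + p * (c * eval g t)           ≡⟨ p*cg≡qr t ⟩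
    eval q t * eval r t            ≡⟨ cong (_* eval r t) (q≡pq′ t) ⟩
    (+ p * eval q′ t) * eval r t   ≡⟨ ℤP.*-assoc (+ p) (eval q′ t) (eval r t) ⟩
    + p * (eval q′ t * eval r t)   ∎))
  cancel (inj₂ p∣r) with ∣ᶜ⇒multiple (+ p) r p∣r
  ... | r′ , r≡pr′ = inj₂ (r′ , r≡pr′ , λ t → ℤP.*-cancelˡ-≡ (+ p) _ _ (begin
    + p * (c * eval g t)           ≡⟨ p*cg≡qr t ⟩
    eval q t * eval r t            ≡⟨ cong (eval q t *_) (r≡pr′ t) ⟩
    eval q t * (+ p * eval r′ t)   ≡⟨ ℤP.*-assoc (eval q t) (+ p) (eval r′ t) ⟨
    (eval q t * + p) * eval r′ t   ≡⟨ cong (_* eval r′ t) (ℤP.*-comm (eval q t) (+ p)) ⟩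
    (+ p * eval q t) * eval r′ t   ≡⟨ ℤP.*-assoc (+ p) (eval q t) (eval r′ t) ⟩
    + p * (eval q t * eval r′ t)   ∎))

gauss-factorisation′ : ∀ ps → All Prime ps → ∀ c g q r → ∣ c ∣ ≡ product ps →
  (∀ t → c * eval g t ≡ eval q t * eval r t) → ScaledFactor g r
gauss-factorisation′ [] [] c g q r ∣c∣≡1 cg≡qr =
  scaleₚ c q , r , 1ℤ , (λ t → sym (ℤP.*-identityˡ (eval r t))) , λ t → begin
    eval g t                      ≡⟨ ℤP.*-identityˡ (eval g t) ⟨
    1ℤ * eval g t                 ≡⟨ cong (_* eval g t) (∣ε∣≡1⇒ε*ε≡1 c ∣c∣≡1) ⟨
    (c * c) * eval g t            ≡⟨ ℤP.*-assoc c c (eval g t) ⟩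
    c * (c * eval g t)            ≡⟨ cong (c *_) (cg≡qr t) ⟩
    c * (eval q t * eval r t)     ≡⟨ ℤP.*-assoc c (eval q t) (eval r t) ⟨
    (c * eval q t) * eval r t     ≡⟨ cong (_* eval r t) (eval-scaleₚ c q t) ⟨
    eval (scaleₚ c q) t * eval r t ∎
  where open ≡-Reasoning
gauss-factorisation′ (p ∷ ps) (pr ∷ prs) c g q r ∣c∣≡p*ps cg≡qr
  with ℤD.∣ᵤ⇒∣ {+ p} {c} (ℕD.divides (product ps) (trans ∣c∣≡p*ps (ℕP.*-comm p (product ps))))
... | divides c′ refl =
  [ (λ { (q′ , _ , c′g≡q′r) → gauss-factorisation′ ps prs c′ g q′ r ∣c′∣≡ps c′g≡q′r })
  , (λ { (r′ , r≡pr′ , c′g≡qr′) → rescale r′ r≡pr′ (gauss-factorisation′ ps prs c′ g q r′ ∣c′∣≡ps c′g≡qr′) })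
  ]′ (cancel-prime pr c′ g q r cg≡qr)
  where
  open ≡-Reasoning
  ∣c′∣≡ps : ∣ c′ ∣ ≡ product ps
  ∣c′∣≡ps = ℕP.*-cancelʳ-≡ ∣ c′ ∣ (product ps) p {{prime⇒nonZero pr}}
    (trans (sym (ℤP.abs-* c′ (+ p))) (trans ∣c∣≡p*ps (ℕP.*-comm p (product ps))))
  rescale : ∀ r′ → (∀ t → eval r t ≡ + p * eval r′ t) → ScaledFactor g r′ → ScaledFactor g r
  rescale r′ r≡pr′ (q₁ , r₁ , k , r′≡kr₁ , g≡q₁r₁) = q₁ , r₁ , + p * k , (λ t → begin
    eval r t               ≡⟨ r≡pr′ t ⟩
    + p * eval r′ t        ≡⟨ cong (+ p *_) (r′≡kr₁ t) ⟩
    + p * (k * eval r₁ t)  ≡⟨ ℤP.*-assoc (+ p) k (eval r₁ t) ⟨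
    (+ p * k) * eval r₁ t  ∎) , g≡q₁r₁

gauss-factorisation : ∀ c g q r → c ≢ 0ℤ →
  (∀ t → c * eval g t ≡ eval q t * eval r t) → ScaledFactor g r
gauss-factorisation c g q r c≢0 = gauss-factorisation′
  (PrimeFactorisation.factors F) (PrimeFactorisation.factorsPrime F) c g q r
  (PrimeFactorisation.isFactorisation F)
  where
  F : PrimeFactorisation ∣ c ∣
  F = factorise ∣ c ∣ {{ℕ.≢-nonZero (c≢0 ∘ ℤP.∣i∣≡0⇒i≡0)}}

infix 4 _∣ℚ_
_∣ℚ_ : Poly → Poly → Set
r ∣ℚ g = ∃[ e ] ∃[ q ] (e ≢ 0ℤ × (∀ t → e * eval g t ≡ eval q t * eval r t))

sign-absorb : ∀ a σ z → ∣ σ ∣ ≡ 1 → a * z ≡ (a * σ) * (σ * z)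
sign-absorb a σ z ∣σ∣≡1 = begin
  a * z                  ≡⟨ cong (a *_) (ℤP.*-identityˡ z) ⟨
  a * (1ℤ * z)           ≡⟨ cong (λ v → a * (v * z)) (∣ε∣≡1⇒ε*ε≡1 σ ∣σ∣≡1) ⟨
  a * ((σ * σ) * z)      ≡⟨ regroup a σ z ⟩
  (a * σ) * (σ * z)      ∎
  where
  open ≡-Reasoning
  regroup : ∀ a σ z → a * ((σ * σ) * z) ≡ (a * σ) * (σ * z)
  regroup = solve-∀

∣ℚ-irreducible⇒multiple : ∀ g r → Irreducibleₚ g → PositiveDegree r → r ∣ℚ g →
  ∃[ κ ] (∀ t → eval r t ≡ κ * eval g t)
∣ℚ-irreducible⇒multiple g r irr pd (e , q , e≢0 , eg≡qr) =
  rescale (gauss-factorisation e g q r e≢0 eg≡qr)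
  where
  rescale : ScaledFactor g r → ∃[ κ ] (∀ t → eval r t ≡ κ * eval g t)
  rescale (q₁ , r₁ , k , r≡kr₁ , g≡q₁r₁) = sign-flip
    (irreducible-factor g q₁ r₁ irr (positiveDegree-multiple⇒¬unit r k r₁ pd r≡kr₁) g≡q₁r₁)
    where
    sign-flip : SignMultiple g r₁ → ∃[ κ ] (∀ t → eval r t ≡ κ * eval g t)
    sign-flip (ε , ∣ε∣≡1 , g≡εr₁) = k * ε , λ t →
      trans (r≡kr₁ t) (trans (sign-absorb k ε (eval r₁ t) ∣ε∣≡1) (cong (k * ε *_) (sym (g≡εr₁ t))))

multiple-of-irreducible⇒associated : ∀ g h c κ → Irreducibleₚ g → PositiveDegree g →
  Irreducibleₚ h → c ≢ 0ℤ → (∀ t → c * eval h t ≡ κ * eval g t) → Associated g h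
multiple-of-irreducible⇒associated g h c κ irr-g pd-g irr-h c≢0 ch≡κg =
  common-factor (gauss-factorisation c h (κ ∷ []) g c≢0 ch≡κ·g)
  where
  ch≡κ·g : ∀ t → c * eval h t ≡ eval (κ ∷ []) t * eval g t
  ch≡κ·g t = trans (ch≡κg t) (cong (_* eval g t) (sym (eval-const κ t)))
  common-factor : ScaledFactor h g → Associated g h
  common-factor (q₁ , r₁ , k , g≡kr₁ , h≡q₁r₁) =
    associate (irreducible-factor g (k ∷ []) r₁ irr-g ¬unit-r₁ g≡k·r₁)
              (irreducible-factor h q₁ r₁ irr-h ¬unit-r₁ h≡q₁r₁)
    where
    ¬unit-r₁ : ¬ IsUnitₚ r₁
    ¬unit-r₁ = positiveDegree-multiple⇒¬unit g k r₁ pd-g g≡kr₁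
    g≡k·r₁ : ∀ t → eval g t ≡ eval (k ∷ []) t * eval r₁ t
    g≡k·r₁ t = trans (g≡kr₁ t) (cong (_* eval r₁ t) (sym (eval-const k t)))
    associate : SignMultiple g r₁ → SignMultiple h r₁ → Associated g h
    associate (ε , ∣ε∣≡1 , g≡εr₁) (δ , ∣δ∣≡1 , h≡δr₁) =
      sign-multiple⇒associated g h (ε * δ) (∣ε*δ∣≡1 ε δ ∣ε∣≡1 ∣δ∣≡1) λ t →
        trans (g≡εr₁ t) (trans (sign-absorb ε δ (eval r₁ t) ∣δ∣≡1) (cong (ε * δ *_) (sym (h≡δr₁ t))))

common-∣ℚ⇒associated : ∀ g h r → Irreducibleₚ g → PositiveDegree g → Irreducibleₚ h →
  PositiveDegree r → r ∣ℚ g → r ∣ℚ h → Associated g h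
common-∣ℚ⇒associated g h r irr-g pd-g irr-h pd-r r∣g r∣h =
  combine (∣ℚ-irreducible⇒multiple g r irr-g pd-r r∣g) (∣ℚ-irreducible⇒multiple h r irr-h pd-r r∣h)
  where
  combine : ∃[ κ ] (∀ t → eval r t ≡ κ * eval g t) → ∃[ κ′ ] (∀ t → eval r t ≡ κ′ * eval h t) →
            Associated g h
  combine (κ , r≡κg) (κ′ , r≡κ′h) =
    multiple-of-irreducible⇒associated g h κ′ κ irr-g pd-g irr-h κ′≢0 λ t →
      trans (sym (r≡κ′h t)) (r≡κg t)
    where
    κ′≢0 : κ′ ≢ 0ℤ
    κ′≢0 refl = positiveDegree⇒unbounded r 0 pd-r λ t → ℕP.≤-reflexive (cong ∣_∣ (r≡κ′h t))

-- Pseudo-division and a Bézout identity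

DegreeBelow : Poly → ℕ → Set
DegreeBelow p n = ∀ k → n ≤ k → coeff p k ≡ 0ℤ

degreeBelow-length : ∀ p → DegreeBelow p (length p)
degreeBelow-length []      k       _         = refl
degreeBelow-length (a ∷ p) (suc k) (s≤s n≤k) = degreeBelow-length p k n≤k

degreeBelow-pred : ∀ p n → DegreeBelow p (suc n) → coeff p n ≡ 0ℤ → DegreeBelow p n
degreeBelow-pred p n p<n+1 pₙ≡0 k n≤k with n ℕ.≟ k
... | yes refl = pₙ≡0
... | no  n≢k  = p<n+1 k (ℕP.≤∧≢⇒< n≤k n≢k)

shiftₚ : ℕ → Poly → Poly
shiftₚ zero    p = p
shiftₚ (suc j) p = 0ℤ ∷ shiftₚ j p

eval-shiftₚ : ∀ j p t → eval (shiftₚ j p) t ≡ t ℤ.^ j * eval p t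
eval-shiftₚ zero    p t = sym (ℤP.*-identityˡ (eval p t))
eval-shiftₚ (suc j) p t rewrite eval-shiftₚ j p t = step t (t ℤ.^ j) (eval p t)
  where
  step : ∀ t x y → 0ℤ + t * (x * y) ≡ (t * x) * y
  step = solve-∀

coeff-shiftₚ : ∀ j p k → coeff (shiftₚ j p) (j ℕ.+ k) ≡ coeff p k
coeff-shiftₚ zero    p k = refl
coeff-shiftₚ (suc j) p k = coeff-shiftₚ j p k

degreeBelow-shiftₚ : ∀ j p n → DegreeBelow p n → DegreeBelow (shiftₚ j p) (j ℕ.+ n)
degreeBelow-shiftₚ zero    p n p<n = p<n
degreeBelow-shiftₚ (suc j) p n p<n zero    ()
degreeBelow-shiftₚ (suc j) p n p<n (suc k) (s≤s j+n≤k) = degreeBelow-shiftₚ j p n p<n k j+n≤k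

cancel-leading : Poly → ℕ → Poly → ℕ → Poly
cancel-leading r m s n = scaleₚ (coeff r m) s +ₚ negₚ (scaleₚ (coeff s n) (shiftₚ (n ∸ m) r))

eval-cancel-leading : ∀ r m s n t → eval (cancel-leading r m s n) t ≡
  coeff r m * eval s t + - (coeff s n * (t ℤ.^ (n ∸ m) * eval r t))
eval-cancel-leading r m s n t
  rewrite eval-+ₚ (scaleₚ (coeff r m) s) (negₚ (scaleₚ (coeff s n) (shiftₚ (n ∸ m) r))) t
        | eval-negₚ (scaleₚ (coeff s n) (shiftₚ (n ∸ m) r)) t
        | eval-scaleₚ (coeff s n) (shiftₚ (n ∸ m) r) t
        | eval-scaleₚ (coeff r m) s t
        | eval-shiftₚ (n ∸ m) r t = refl

coeff-cancel-leading : ∀ r m s n k → coeff (cancel-leading r m s n) k ≡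
  coeff r m * coeff s k + - (coeff s n * coeff (shiftₚ (n ∸ m) r) k)
coeff-cancel-leading r m s n k
  rewrite coeff-+ₚ (scaleₚ (coeff r m) s) (negₚ (scaleₚ (coeff s n) (shiftₚ (n ∸ m) r))) k
        | coeff-negₚ (scaleₚ (coeff s n) (shiftₚ (n ∸ m) r)) k
        | coeff-scaleₚ (coeff s n) (shiftₚ (n ∸ m) r) k
        | coeff-scaleₚ (coeff r m) s k = refl

degreeBelow-cancel-leading : ∀ r m s n → DegreeBelow r (suc m) → m ≤ n → DegreeBelow s (suc n) →
  DegreeBelow (cancel-leading r m s n) n
degreeBelow-cancel-leading r m s n r<m+1 m≤n s<n+1 =
  degreeBelow-pred (cancel-leading r m s n) n below (begin
    coeff (cancel-leading r m s n) n  ≡⟨ coeff-cancel-leading r m s n n ⟩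
    c * sₙ + - (sₙ * coeff r′ n)      ≡⟨ cong (λ v → c * sₙ + - (sₙ * v)) r′ₙ≡c ⟩
    c * sₙ + - (sₙ * c)               ≡⟨ cancel c sₙ ⟩
    0ℤ                                ∎)
  where
  open ≡-Reasoning
  c sₙ : ℤ
  c = coeff r m
  sₙ = coeff s n
  j : ℕ
  j = n ∸ m
  r′ : Poly
  r′ = shiftₚ j r
  j+m≡n : j ℕ.+ m ≡ n
  j+m≡n = ℕP.m∸n+n≡m m≤n
  r′ₙ≡c : coeff r′ n ≡ c
  r′ₙ≡c = trans (cong (coeff r′) (sym j+m≡n)) (coeff-shiftₚ j r m)
  below : DegreeBelow (cancel-leading r m s n) (suc n)
  below k n<k = begin
    coeff (cancel-leading r m s n) k   ≡⟨ coeff-cancel-leading r m s n k ⟩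
    c * coeff s k + - (sₙ * coeff r′ k) ≡⟨ cong₂ (λ x y → c * x + - (sₙ * y)) (s<n+1 k n<k)
                                           (degreeBelow-shiftₚ j r (suc m) r<m+1 k
                                             (subst (_≤ k) (sym (trans (ℕP.+-suc j m) (cong suc j+m≡n))) n<k)) ⟩
    c * 0ℤ + - (sₙ * 0ℤ)                ≡⟨ vanish c sₙ ⟩
    0ℤ                                  ∎
    where
    vanish : ∀ x y → x * 0ℤ + - (y * 0ℤ) ≡ 0ℤ
    vanish = solve-∀
  cancel : ∀ x y → x * y + - (y * x) ≡ 0ℤ
  cancel = solve-∀

private
  pseudo-split : ∀ e c x y T z → (e * c) * x ≡ e * (c * x + - (y * (T * z))) + T * (e * y) * z
  pseudo-split = solve-∀
  pseudo-regroup : ∀ x y z w → x * y + z + w * y ≡ (x + w) * y + z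
  pseudo-regroup = solve-∀

PseudoRemainder : Poly → ℕ → Poly → Set
PseudoRemainder r m s = ∃[ e ] ∃[ q ] ∃[ s′ ]
  (e ≢ 0ℤ × DegreeBelow s′ m × (∀ t → e * eval s t ≡ eval q t * eval r t + eval s′ t))

-- Cancelling the leading term of s costs the factor c = rₘ and adds e sₙ tʲ to the quotient.
pseudoRemainder-cancel-leading : ∀ r m s n → coeff r m ≢ 0ℤ →
  PseudoRemainder r m (cancel-leading r m s n) → PseudoRemainder r m s
pseudoRemainder-cancel-leading r m s n c≢0 (e , q , s′ , e≢0 , s′<m , es₁≡qr+s′) =
  e * c , q′ , s′ , *-≢0 e≢0 c≢0 , s′<m , λ t → begin
    (e * c) * eval s t
      ≡⟨ pseudo-split e c (eval s t) sₙ (t ℤ.^ j) (eval r t) ⟩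
    e * (c * eval s t + - (sₙ * (t ℤ.^ j * eval r t))) + t ℤ.^ j * (e * sₙ) * eval r t
      ≡⟨ cong (λ v → e * v + t ℤ.^ j * (e * sₙ) * eval r t) (eval-cancel-leading r m s n t) ⟨
    e * eval (cancel-leading r m s n) t + t ℤ.^ j * (e * sₙ) * eval r t
      ≡⟨ cong (_+ t ℤ.^ j * (e * sₙ) * eval r t) (es₁≡qr+s′ t) ⟩
    eval q t * eval r t + eval s′ t + t ℤ.^ j * (e * sₙ) * eval r t
      ≡⟨ pseudo-regroup (eval q t) (eval r t) (eval s′ t) (t ℤ.^ j * (e * sₙ)) ⟩
    (eval q t + t ℤ.^ j * (e * sₙ)) * eval r t + eval s′ t
      ≡⟨ cong (λ v → v * eval r t + eval s′ t) (eval-q′ t) ⟨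
    eval q′ t * eval r t + eval s′ t
      ∎
  where
  open ≡-Reasoning
  c sₙ : ℤ
  c = coeff r m
  sₙ = coeff s n
  j : ℕ
  j = n ∸ m
  q′ : Poly
  q′ = q +ₚ shiftₚ j ((e * sₙ) ∷ [])
  eval-q′ : ∀ t → eval q′ t ≡ eval q t + t ℤ.^ j * (e * sₙ)
  eval-q′ t rewrite eval-+ₚ q (shiftₚ j ((e * sₙ) ∷ [])) t | eval-shiftₚ j ((e * sₙ) ∷ []) t
                  | eval-const (e * sₙ) t = refl

pseudo-division : ∀ r m → DegreeBelow r (suc m) → coeff r m ≢ 0ℤ → ∀ s → PseudoRemainder r m s
pseudo-division r m r<m+1 c≢0 s = reduce (length s) s (degreeBelow-length s)
  where
  reduce : ∀ n s → DegreeBelow s n → PseudoRemainder r m s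
  reduce n s s<n with n ℕ.≤? m
  reduce n s s<n | yes n≤m =
    1ℤ , [] , s , (λ ()) , (λ k m≤k → s<n k (ℕP.≤-trans n≤m m≤k)) , λ t → trivial (eval s t) (eval r t)
    where
    trivial : ∀ x y → 1ℤ * x ≡ 0ℤ * y + x
    trivial = solve-∀
  reduce zero s s<n | no 0≰m = ⊥-elim (0≰m z≤n)
  reduce (suc n) s s<n+1 | no n+1≰m = pseudoRemainder-cancel-leading r m s n c≢0
    (reduce n (cancel-leading r m s n)
      (degreeBelow-cancel-leading r m s n r<m+1 (ℕP.≤-pred (ℕP.≰⇒> n+1≰m)) s<n+1))

infix 4 _∈⟨_,_⟩
_∈⟨_,_⟩ : Poly → Poly → Poly → Set
r ∈⟨ g , h ⟩ = ∃[ u ] ∃[ v ] (∀ t → eval r t ≡ eval u t * eval g t + eval v t * eval h t)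

private
  left-combination : ∀ x y → x ≡ 1ℤ * x + 0ℤ * y
  left-combination = solve-∀
  right-combination : ∀ x y → y ≡ 0ℤ * x + 1ℤ * y
  right-combination = solve-∀
  isolate-remainder : ∀ q r s′ → s′ ≡ (q * r + s′) + - (q * r)
  isolate-remainder = solve-∀
  expand-remainder : ∀ e q uₛ vₛ uᵣ vᵣ g h →
    e * (uₛ * g + vₛ * h) + - (q * (uᵣ * g + vᵣ * h)) ≡
    (e * uₛ + - (q * uᵣ)) * g + (e * vₛ + - (q * vᵣ)) * h
  expand-remainder = solve-∀

left∈⟨,⟩ : ∀ g h → g ∈⟨ g , h ⟩
left∈⟨,⟩ g h = oneₚ , [] , λ t →
  trans (left-combination (eval g t) (eval h t)) (cong (λ v → v * eval g t + 0ℤ * eval h t) (sym (eval-oneₚ t)))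

right∈⟨,⟩ : ∀ g h → h ∈⟨ g , h ⟩
right∈⟨,⟩ g h = [] , oneₚ , λ t →
  trans (right-combination (eval g t) (eval h t)) (cong (λ v → 0ℤ * eval g t + v * eval h t) (sym (eval-oneₚ t)))

∈⟨,⟩-pseudoRemainder : ∀ g h s r e q s′ → s ∈⟨ g , h ⟩ → r ∈⟨ g , h ⟩ →
  (∀ t → e * eval s t ≡ eval q t * eval r t + eval s′ t) → s′ ∈⟨ g , h ⟩
∈⟨,⟩-pseudoRemainder g h s r e q s′ (uₛ , vₛ , s≡) (uᵣ , vᵣ , r≡) es≡qr+s′ =
  combine uₛ uᵣ , combine vₛ vᵣ , λ t → begin
    eval s′ t
      ≡⟨ isolate-remainder (eval q t) (eval r t) (eval s′ t) ⟩
    eval q t * eval r t + eval s′ t + - (eval q t * eval r t)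
      ≡⟨ cong (_+ - (eval q t * eval r t)) (es≡qr+s′ t) ⟨
    e * eval s t + - (eval q t * eval r t)
      ≡⟨ cong₂ (λ x y → e * x + - (eval q t * y)) (s≡ t) (r≡ t) ⟩
    e * (eval uₛ t * eval g t + eval vₛ t * eval h t) + - (eval q t * (eval uᵣ t * eval g t + eval vᵣ t * eval h t))
      ≡⟨ expand-remainder e (eval q t) (eval uₛ t) (eval vₛ t) (eval uᵣ t) (eval vᵣ t) (eval g t) (eval h t) ⟩
    (e * eval uₛ t + - (eval q t * eval uᵣ t)) * eval g t + (e * eval vₛ t + - (eval q t * eval vᵣ t)) * eval h t
      ≡⟨ cong₂ (λ x y → x * eval g t + y * eval h t) (eval-combine uₛ uᵣ t) (eval-combine vₛ vᵣ t) ⟨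
    eval (combine uₛ uᵣ) t * eval g t + eval (combine vₛ vᵣ) t * eval h t
      ∎
  where
  open ≡-Reasoning
  combine : Poly → Poly → Poly
  combine a b = scaleₚ e a +ₚ negₚ (q *ₚ b)
  eval-combine : ∀ a b t → eval (combine a b) t ≡ e * eval a t + - (eval q t * eval b t)
  eval-combine a b t rewrite eval-+ₚ (scaleₚ e a) (negₚ (q *ₚ b)) t | eval-scaleₚ e a t
                           | eval-negₚ (q *ₚ b) t | eval-*ₚ q b t = refl

exact-pseudoDivision : ∀ e s q r s′ → IsZeroₚ s′ →
  (∀ t → e * eval s t ≡ eval q t * eval r t + eval s′ t) → ∀ t → e * eval s t ≡ eval q t * eval r t
exact-pseudoDivision e s q r s′ s′≡0 es≡qr+s′ t = begin
  e * eval s t                      ≡⟨ es≡qr+s′ t ⟩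
  eval q t * eval r t + eval s′ t   ≡⟨ cong (λ v → eval q t * eval r t + v) (eval-isZero s′ s′≡0 t) ⟩
  eval q t * eval r t + 0ℤ          ≡⟨ ℤP.+-identityʳ (eval q t * eval r t) ⟩
  eval q t * eval r t               ∎
  where open ≡-Reasoning

BezoutIdentity : Poly → Poly → Set
BezoutIdentity g h = ∃[ u ] ∃[ v ] ∃[ N ]
  (N ≢ 0ℤ × (∀ t → eval u t * eval g t + eval v t * eval h t ≡ N))

-- Euclid's algorithm with pseudo-remainders: the ideal ⟨g, h⟩ is searched for a
-- nonzero element of ever smaller degree; a positive-degree element dividing
-- both g and h over ℚ is excluded, so the search ends at a nonzero constant.
bezout : ∀ g h → NonZeroₚ g → ¬ (∃[ r ] (PositiveDegree r × r ∣ℚ g × r ∣ℚ h)) → BezoutIdentity g h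
bezout g h g≢0 no-common-factor =
  descend (length g) g (left∈⟨,⟩ g h) (λ k len<k → degreeBelow-length g k (ℕP.≤-trans (ℕP.n≤1+n _) len<k)) g≢0
  where
  descend : ∀ m r → r ∈⟨ g , h ⟩ → DegreeBelow r (suc m) → NonZeroₚ r → BezoutIdentity g h
  descend zero r (u , v , r≡ug+vh) r<1 (n , rₙ≢0) =
    u , v , coeff r 0 , r₀≢0 n rₙ≢0 , λ t →
      trans (sym (r≡ug+vh t)) (eval-constant r (λ k → r<1 (suc k) (s≤s z≤n)) t)
    where
    r₀≢0 : ∀ n → coeff r n ≢ 0ℤ → coeff r 0 ≢ 0ℤ
    r₀≢0 zero    ≢0   = ≢0
    r₀≢0 (suc n) rₙ≢0 = ⊥-elim (rₙ≢0 (r<1 (suc n) (s≤s z≤n)))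
  descend (suc m) r r∈ r<m+2 r≢0 with coeff r (suc m) ℤ.≟ 0ℤ
  ... | yes rₘ₊₁≡0 = descend m r r∈ (degreeBelow-pred r (suc m) r<m+2 rₘ₊₁≡0) r≢0
  ... | no  rₘ₊₁≢0 = reduce (divide g) (divide h)
    where
    divide : ∀ s → PseudoRemainder r (suc m) s
    divide = pseudo-division r (suc m) r<m+2 rₘ₊₁≢0
    reduce : PseudoRemainder r (suc m) g → PseudoRemainder r (suc m) h → BezoutIdentity g h
    reduce (e , q , s , e≢0 , s<m+1 , eg≡qr+s) (e′ , q′ , s′ , e′≢0 , s′<m+1 , e′h≡q′r+s′)
      with isZero⊎nonZero s | isZero⊎nonZero s′
    ... | inj₂ s≢0 | _ =
      descend m s (∈⟨,⟩-pseudoRemainder g h g r e q s (left∈⟨,⟩ g h) r∈ eg≡qr+s) s<m+1 s≢0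
    ... | inj₁ _ | inj₂ s′≢0 =
      descend m s′ (∈⟨,⟩-pseudoRemainder g h h r e′ q′ s′ (right∈⟨,⟩ g h) r∈ e′h≡q′r+s′) s′<m+1 s′≢0
    ... | inj₁ s≡0 | inj₁ s′≡0 = ⊥-elim (no-common-factor
      (r , (m , rₘ₊₁≢0) , (e , q , e≢0 , exact-pseudoDivision e g q r s s≡0 eg≡qr+s)
                        , (e′ , q′ , e′≢0 , exact-pseudoDivision e′ h q′ r s′ s′≡0 e′h≡q′r+s′)))

-- Prime-power values

prime-power-divisor : ∀ {p} → Prime p → ∀ e {x} → x ℕD.∣ p ^ e → ∃[ a ] x ≡ p ^ a
prime-power-divisor pr zero    x∣1 = 0 , ℕD.∣1⇒≡1 x∣1
prime-power-divisor {p} pr (suc e) {x} x∣pᵉ⁺¹ with p ℕD.∣? x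
... | yes (ℕD.divides k refl) with prime-power-divisor pr e
      (ℕD.*-cancelˡ-∣ p {{prime⇒nonZero pr}} (subst (ℕD._∣ p ^ suc e) (ℕP.*-comm k p) x∣pᵉ⁺¹))
...   | a , refl = suc a , ℕP.*-comm (p ^ a) p
prime-power-divisor {p} pr (suc e) {x} x∣pᵉ⁺¹ | no p∤x =
  prime-power-divisor pr e (coprime-divisor x⊥p x∣pᵉ⁺¹)
  where
  x⊥p : Coprime x p
  x⊥p (d∣x , d∣p) with prime⇒irreducible pr d∣p
  ... | inj₁ d≡1 = d≡1
  ... | inj₂ refl = ⊥-elim (p∤x d∣x)

^-monoʳ-∣ : ∀ p {a b} → a ≤ b → p ^ a ℕD.∣ p ^ b
^-monoʳ-∣ p {a} {b} a≤b = ℕD.divides (p ^ (b ∸ a)) (begin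
  p ^ b                   ≡⟨ cong (p ^_) (ℕP.m+[n∸m]≡n a≤b) ⟨
  p ^ (a ℕ.+ (b ∸ a))     ≡⟨ ℕP.^-distribˡ-+-* p a (b ∸ a) ⟩
  p ^ a ℕ.* p ^ (b ∸ a)   ≡⟨ ℕP.*-comm (p ^ a) (p ^ (b ∸ a)) ⟩
  p ^ (b ∸ a) ℕ.* p ^ a   ∎)
  where open ≡-Reasoning

prime-power-divisors-comparable : ∀ {p} → Prime p → ∀ e {x y} → x ℕD.∣ p ^ e → y ℕD.∣ p ^ e →
  x ℕD.∣ y ⊎ y ℕD.∣ x
prime-power-divisors-comparable {p} pr e x∣pᵉ y∣pᵉ
  with prime-power-divisor pr e x∣pᵉ | prime-power-divisor pr e y∣pᵉ
... | a , refl | b , refl with ℕP.≤-total a b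
...   | inj₁ a≤b = inj₁ (^-monoʳ-∣ p a≤b)
...   | inj₂ b≤a = inj₂ (^-monoʳ-∣ p b≤a)

∣ₚ⇒∣eval∣ : ∀ g f → g ∣ₚ f → ∀ t → ∣ eval g t ∣ ℕD.∣ ∣ eval f t ∣
∣ₚ⇒∣eval∣ g f (k , gk≈f) t = ℕD.divides ∣ eval k t ∣ (begin
  ∣ eval f t ∣                    ≡⟨ cong ∣_∣ (eval-cong (g *ₚ k) f gk≈f t) ⟨
  ∣ eval (g *ₚ k) t ∣             ≡⟨ cong ∣_∣ (eval-*ₚ g k t) ⟩
  ∣ eval g t * eval k t ∣         ≡⟨ ℤP.abs-* (eval g t) (eval k t) ⟩
  ∣ eval g t ∣ ℕ.* ∣ eval k t ∣   ≡⟨ ℕP.*-comm ∣ eval g t ∣ ∣ eval k t ∣ ⟩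
  ∣ eval k t ∣ ℕ.* ∣ eval g t ∣   ∎)
  where open ≡-Reasoning

∣-linearCombination⇒≤ : ∀ x y u v N → N ≢ 0ℤ → ∣ x ∣ ℕD.∣ ∣ y ∣ → u * x + v * y ≡ N → ∣ x ∣ ≤ ∣ N ∣
∣-linearCombination⇒≤ x y u v N N≢0 x∣y ux+vy≡N =
  ℕD.∣⇒≤ {{ℕ.≢-nonZero (N≢0 ∘ ℤP.∣i∣≡0⇒i≡0)}} (ℤD.∣⇒∣ᵤ (subst (x ℤD.∣_) ux+vy≡N
    (ℤD.∣m∣n⇒∣m+n (ℤD.∣n⇒∣m*n u ℤD.∣-refl) (ℤD.∣n⇒∣m*n v (ℤD.∣ᵤ⇒∣ x∣y)))))

prime-power-values-bounded : ∀ f g h → g ∣ₚ f → h ∣ₚ f → BezoutIdentity g h → Growth g → Growth h →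
  ∃[ B ] (∀ t p e → Prime p → eval f t ≡ + (p ^ e) → ∣ t ∣ ≤ B)
prime-power-values-bounded f g h g∣f h∣f (u , v , N , N≢0 , ug+vh≡N) (Mg , growth-g) (Mh , growth-h) =
  ∣ N ∣ ℕ.+ (Mg ℕ.+ Mh) , bounded
  where
  bounded : ∀ t p e → Prime p → eval f t ≡ + (p ^ e) → ∣ t ∣ ≤ ∣ N ∣ ℕ.+ (Mg ℕ.+ Mh)
  bounded t p e pr f≡pᵉ =
    [ (λ g∣h → ℕP.≤-trans (growth-g t) (ℕP.+-mono-≤
        (∣-linearCombination⇒≤ (eval g t) (eval h t) (eval u t) (eval v t) N N≢0 g∣h (ug+vh≡N t))
        (ℕP.m≤m+n Mg Mh)))
    , (λ h∣g → ℕP.≤-trans (growth-h t) (ℕP.+-mono-≤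
        (∣-linearCombination⇒≤ (eval h t) (eval g t) (eval v t) (eval u t) N N≢0 h∣g
          (trans (ℤP.+-comm (eval v t * eval h t) (eval u t * eval g t)) (ug+vh≡N t)))
        (ℕP.m≤n+m Mh Mg)))
    ]′ (prime-power-divisors-comparable pr e (factor∣pᵉ g g∣f) (factor∣pᵉ h h∣f))
    where
    factor∣pᵉ : ∀ k → k ∣ₚ f → ∣ eval k t ∣ ℕD.∣ p ^ e
    factor∣pᵉ k k∣f = subst (∣ eval k t ∣ ℕD.∣_) (cong ∣_∣ f≡pᵉ) (∣ₚ⇒∣eval∣ k f k∣f t)

mainTheorem2 : (f : Poly) →
    (∃[ g ] ∃[ h ] (Irreducibleₚ g × PositiveDegree g × g ∣ₚ f ×
                    Irreducibleₚ h × PositiveDegree h × h ∣ₚ f ×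
                    ¬ Associated g h)) →
    ∃[ B ] (∀ (t : ℤ) → (∃[ p ] ∃[ e ] (Prime p × 1 ≤ e × eval f t ≡ + (p ^ e))) →
                        ∣ t ∣ ≤ B)
mainTheorem2 f (g , h , irr-g , pd-g@(n , gₙ₊₁≢0) , g∣f , irr-h , pd-h , h∣f , g≉h) =
  forget-exponent (prime-power-values-bounded f g h g∣f h∣f
    (bezout g h (suc n , gₙ₊₁≢0) no-common-factor)
    (positiveDegree-growth g pd-g) (positiveDegree-growth h pd-h))
  where
  no-common-factor : ¬ (∃[ r ] (PositiveDegree r × r ∣ℚ g × r ∣ℚ h))
  no-common-factor (r , pd-r , r∣g , r∣h) =
    g≉h (common-∣ℚ⇒associated g h r irr-g pd-g irr-h pd-r r∣g r∣h)

  -- The bound also covers f(t) = 1.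
  forget-exponent : ∃[ B ] (∀ t p e → Prime p → eval f t ≡ + (p ^ e) → ∣ t ∣ ≤ B) →
    ∃[ B ] (∀ t → (∃[ p ] ∃[ e ] (Prime p × 1 ≤ e × eval f t ≡ + (p ^ e))) → ∣ t ∣ ≤ B)
  forget-exponent (B , bounded) = B , λ { t (p , e , pr , _ , f≡pᵉ) → bounded t p e pr f≡pᵉ }
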